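{- Let $H=(C\cup P,E_t)$ be a bipartite graph with sides $C$ and $P$, and let $C=T_1\cup T_2\cup\dots\cup T_k$ be a partition of $C$. Assign to every edge of $E_t$ incident to a vertex of $T_i$ the rank $i$. Then every rank-maximal matching of $H$ is a maximum (cardinality) matching of $H$.
   Context: A matching $N$ of $H$ is rank-maximal if it contains the maximum possible number of rank-$1$ edges among all matchings of $H$, subject to this the maximum possible number of rank-$2$ edges, and so on for ranks $3,\dots,k$ (i.e., its vector of numbers of edges of ranks $1,2,\dots,k$ is lexicographically maximum among all matchings of $H$). -}

module Defs where

open import Data.Nat using (ℕ; zero; suc; _<_; _≤_)
open import Data.Fin using (Fin)
open import Data.Bool using (Bool; true; false; T)
open import Data.Product using (_×_; _,_; proj₁; proj₂)
open import Data.List using (List; length; filter)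
open import Data.List.Relation.Unary.All using (All)
open import Data.List.Relation.Unary.AllPairs using (AllPairs)
open import Data.Vec using (Vec; tabulate)
open import Relation.Binary.PropositionalEquality using (_≡_)
open import Relation.Nullary using (¬_)
open import Data.Fin using (_≟_)

-- A bipartite graph with sides C = Fin c and P = Fin p, given by its
-- adjacency relation (edge set E_t = {(x,y) | T (adj x y)}).
Bip : ℕ → ℕ → Set
Bip c p = Fin c → Fin p → Bool

Edge : ℕ → ℕ → Set
Edge c p = Fin c × Fin p

Disjoint : ∀ {c p} → Edge c p → Edge c p → Set
Disjoint (x , y) (x' , y') = ¬ (x ≡ x') × ¬ (y ≡ y')

-- A matching: a list of edges of H, pairwise vertex-disjoint
-- (in particular no edge is listed twice).
IsMatching : ∀ {c p} → Bip c p → List (Edge c p) → Set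
IsMatching H M = All (λ e → T (H (proj₁ e) (proj₂ e))) M × AllPairs Disjoint M

IsMaximum : ∀ {c p} → Bip c p → List (Edge c p) → Set
IsMaximum H N = IsMatching H N × (∀ M → IsMatching H M → length M ≤ length N)

-- Partition C = T_1 ∪ … ∪ T_k given by the class map cls : C → Fin k;
-- vertex x lies in T_{i+1} iff cls x = i (Fin k is 0-based).
-- The edge (x , y) gets rank cls x + 1.
-- Signature: i-th entry = number of edges of rank i+1 in M.
signature : ∀ {c p k} → (Fin c → Fin k) → List (Edge c p) → Vec ℕ k
signature cls M = tabulate (λ i → length (filter (λ e → cls (proj₁ e) ≟ i) M))

data _≤lex_ : ∀ {k} → Vec ℕ k → Vec ℕ k → Set where
  []≤  : Vec.[] ≤lex Vec.[]
  <≤   : ∀ {k a b} {u v : Vec ℕ k} → a < b → (a Vec.∷ u) ≤lex (b Vec.∷ v)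
  ≡≤   : ∀ {k a} {u v : Vec ℕ k} → u ≤lex v → (a Vec.∷ u) ≤lex (a Vec.∷ v)

IsRankMaximal : ∀ {c p k} → Bip c p → (Fin c → Fin k) → List (Edge c p) → Set
IsRankMaximal H cls N =
  IsMatching H N × (∀ M → IsMatching H M → signature cls M ≤lex signature cls N)

-- If a matching N is smaller than some matching M, it can be augmented to a
-- matching N' covering exactly the C-vertices of N plus one more vertex z.
-- As the rank of an edge depends only on its C-endpoint, the signature of N'
-- is that of N with one more edge of rank cls z, hence lexicographically
-- larger, so N is not rank-maximal.
--
-- The augmentation is by induction on |N|: take an edge (x , y) of M with x
-- unmatched in N. If y is unmatched too, add (x , y). Otherwise y is matched
-- to some x'; augment N - (x' , y) inside the graph H - y, obtaining a new
-- vertex z, then put (x' , y) back if z ≠ x', and add (x , y) if z = x'.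
module Submission where

open import Defs
open import Data.Nat using (ℕ; suc; _<_; _≤_; s<s⁻¹)
open import Data.Nat.Properties using (≤-refl; ≤-reflexive; n≤1+n; ≮⇒≥; <⇒≱; <⇒≢)
open import Data.Nat.Induction using (<-wellFounded)
open import Data.Fin using (Fin; zero; suc; _≟_)
open import Data.Bool using (true; false; T; _∧_; not)
open import Data.Product using (∃; ∃₂; _×_; _,_; proj₁; proj₂)
open import Data.Sum using (_⊎_; inj₁; inj₂)
open import Data.List using (List; []; _∷_; map; length; filter)
open import Data.List.Properties using (length-map; filter-accept)
open import Data.List.Membership.Propositional using (_∈_; _∉_)
open import Data.List.Membership.Propositional.Properties using (∈-map⁻; ∈-∃++)
open import Data.List.Relation.Unary.Any using (here; there)
import Data.List.Relation.Unary.Any.Properties as Any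
open import Data.List.Relation.Unary.All as All using (All; []; _∷_)
open import Data.List.Relation.Unary.All.Properties using (¬Any⇒All¬; All¬⇒¬Any)
open import Data.List.Relation.Unary.AllPairs as AllPairs using (AllPairs; []; _∷_)
import Data.List.Relation.Unary.AllPairs.Properties as AllPairs
open import Data.List.Relation.Unary.Unique.Propositional using (Unique)
open import Data.List.Relation.Binary.Permutation.Propositional
  using (_↭_; ↭-refl; ↭-sym; ↭-trans; prep; ↭⇒↭ₛ′; module PermutationReasoning)
open import Data.List.Relation.Binary.Permutation.Propositional.Properties
  using (∈-resp-↭; All-resp-↭; ↭-length; shift; filter-↭)
  renaming (map⁺ to ↭-map⁺)
import Data.List.Relation.Binary.Permutation.Setoid.Properties as Permutationₛ
open import Data.Vec as Vec using (Vec; tabulate)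
open import Data.Empty using (⊥-elim)
open import Function using (_∘_)
open import Induction.WellFounded using (Acc; acc)
open import Relation.Nullary using (¬_; yes; no; does)
open import Relation.Unary using (Pred; Decidable)
open import Relation.Binary using (Symmetric; Rel; DecidableEquality)
open import Relation.Binary.PropositionalEquality
  using (_≡_; _≢_; refl; sym; trans; subst; subst₂; cong; resp₂; isEquivalence; setoid)

module _ {A : Set} where

  ∈⇒↭ : ∀ {x : A} {xs} → x ∈ xs → ∃ λ ys → xs ↭ x ∷ ys
  ∈⇒↭ {x} x∈xs with ys , zs , refl ← ∈-∃++ x∈xs = _ , shift x ys zs

  ∉-resp-↭ : ∀ {x : A} {xs ys} → xs ↭ ys → x ∉ xs → x ∉ ys
  ∉-resp-↭ xs↭ys x∉xs = x∉xs ∘ ∈-resp-↭ (↭-sym xs↭ys)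

  AllPairs-resp-↭ : ∀ {ℓ} {R : Rel A ℓ} → Symmetric R →
    ∀ {xs ys} → xs ↭ ys → AllPairs R xs → AllPairs R ys
  AllPairs-resp-↭ {R = R} sym-R xs↭ys =
    Permutationₛ.AllPairs-resp-↭ (setoid A) sym-R (resp₂ R) (↭⇒↭ₛ′ isEquivalence xs↭ys)

  module _ (_≟ₐ_ : DecidableEquality A) where
    open import Data.List.Membership.DecPropositional _≟ₐ_ using (_∈?_)

    ∃∉-longer : ∀ {xs ys : List A} → Unique xs → length ys < length xs →
      ∃ λ x → x ∈ xs × x ∉ ys
    ∃∉-longer {x ∷ xs} {ys} (x∉xs ∷ uniq) ys<x∷xs with x ∈? ys
    ... | no x∉ys = x , here refl , x∉ys
    ... | yes x∈ys
      with ys′ , ys↭ ← ∈⇒↭ x∈ys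
      with w , w∈xs , w∉ys′ ← ∃∉-longer uniq (s<s⁻¹ (subst (_< _) (↭-length ys↭) ys<x∷xs))
      = w , there w∈xs , w∉ys
      where
      w∉ys : w ∉ ys
      w∉ys w∈ys with ∈-resp-↭ ys↭ w∈ys
      ... | here refl = All.lookup x∉xs w∈xs refl
      ... | there w∈ys′ = w∉ys′ w∈ys′

  module _ {B : Set} (f : A → B) where

    ∈-map⇒↭ : ∀ {y xs} → y ∈ map f xs → ∃₂ λ x ys → xs ↭ x ∷ ys × y ≡ f x
    ∈-map⇒↭ y∈fxs
      with x , x∈xs , refl ← ∈-map⁻ f y∈fxs
      with ys , xs↭ ← ∈⇒↭ x∈xs
      = x , ys , xs↭ , refl

    All≢⇒∉-map : ∀ {y xs} → All (λ x → y ≢ f x) xs → y ∉ map f xs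
    All≢⇒∉-map y≢fxs = All¬⇒¬Any y≢fxs ∘ Any.map⁻

    ∉-map⇒All≢ : ∀ {y xs} → y ∉ map f xs → All (λ x → y ≢ f x) xs
    ∉-map⇒All≢ y∉fxs = ¬Any⇒All¬ _ (y∉fxs ∘ Any.map⁺)

    length-filter-map : ∀ {ℓ} {P : Pred B ℓ} (P? : Decidable P) xs →
      length (filter P? (map f xs)) ≡ length (filter (P? ∘ f) xs)
    length-filter-map P? [] = refl
    length-filter-map P? (x ∷ xs) with does (P? (f x))
    ... | true = cong suc (length-filter-map P? xs)
    ... | false = length-filter-map P? xs

module _ {A : Set} {ℓ} {P : Pred A ℓ} (P? : Decidable P) where

  length-filter-≤-∷ : ∀ x xs → length (filter P? xs) ≤ length (filter P? (x ∷ xs))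
  length-filter-≤-∷ x xs with does (P? x)
  ... | true = n≤1+n _
  ... | false = ≤-refl

  length-filter-<-∷ : ∀ {x} xs → P x → length (filter P? xs) < length (filter P? (x ∷ xs))
  length-filter-<-∷ xs px = ≤-reflexive (cong length (sym (filter-accept P? px)))

≤lex-∷⁻ : ∀ {k a b} {u v : Vec ℕ k} → (a Vec.∷ u) ≤lex (b Vec.∷ v) →
  a < b ⊎ (a ≡ b × u ≤lex v)
≤lex-∷⁻ (<≤ a<b) = inj₁ a<b
≤lex-∷⁻ (≡≤ u≤v) = inj₂ (refl , u≤v)

tabulate-≰lex : ∀ {k} (f g : Fin k → ℕ) {j} → (∀ i → f i ≤ g i) → f j < g j →
  ¬ (tabulate g ≤lex tabulate f)
tabulate-≰lex {suc _} f g {j} f≤g fj<gj g≤f with ≤lex-∷⁻ g≤f | j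
... | inj₁ g₀<f₀ | _ = <⇒≱ g₀<f₀ (f≤g zero)
... | inj₂ (g₀≡f₀ , _) | zero = <⇒≢ fj<gj (sym g₀≡f₀)
... | inj₂ (_ , g₊≤f₊) | suc j′ = tabulate-≰lex (f ∘ suc) (g ∘ suc) (f≤g ∘ suc) fj<gj g₊≤f₊

module _ {c p : ℕ} where
  open import Data.List.Membership.DecPropositional (_≟_ {p}) using (_∈?_)

  endsC : List (Edge c p) → List (Fin c)
  endsC = map proj₁

  endsP : List (Edge c p) → List (Fin p)
  endsP = map proj₂

  Disjoint-sym : Symmetric (Disjoint {c} {p})
  Disjoint-sym (x≢x′ , y≢y′) = x≢x′ ∘ sym , y≢y′ ∘ sym

  Unique-endsC : ∀ {N} → AllPairs Disjoint N → Unique (endsC N)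
  Unique-endsC = AllPairs.map⁺ ∘ AllPairs.map proj₁

  _∖_ : Bip c p → Fin p → Bip c p
  (H ∖ y) x y′ = H x y′ ∧ not (does (y′ ≟ y))

  ∖-edge⁺ : ∀ {H : Bip c p} {x y y′} → y ≢ y′ → T (H x y′) → T ((H ∖ y) x y′)
  ∖-edge⁺ {H} {x} {y} {y′} y≢y′ hxy′ with y′ ≟ y
  ... | yes refl = ⊥-elim (y≢y′ refl)
  ... | no _ with H x y′
  ...   | true = hxy′

  ∖-edge⁻ : ∀ {H : Bip c p} {x y y′} → T ((H ∖ y) x y′) → T (H x y′) × y ≢ y′
  ∖-edge⁻ {H} {x} {y} {y′} h with y′ ≟ y | H x y′
  ... | no y′≢y | true = h , y′≢y ∘ sym

  IsMatching-resp-↭ : ∀ {H : Bip c p} {N N′} → N ↭ N′ → IsMatching H N → IsMatching H N′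
  IsMatching-resp-↭ N↭N′ (edges , pairs) =
    All-resp-↭ N↭N′ edges , AllPairs-resp-↭ Disjoint-sym N↭N′ pairs

  IsMatching-∷ : ∀ {H : Bip c p} {N x y} → IsMatching H N → T (H x y) →
    x ∉ endsC N → y ∉ endsP N → IsMatching H ((x , y) ∷ N)
  IsMatching-∷ (edges , pairs) hxy x∉N y∉N =
    hxy ∷ edges , All.zip (∉-map⇒All≢ proj₁ x∉N , ∉-map⇒All≢ proj₂ y∉N) ∷ pairs

  IsMatching-∖⁺ : ∀ {H : Bip c p} {N y} → IsMatching H N → y ∉ endsP N → IsMatching (H ∖ y) N
  IsMatching-∖⁺ {H} (edges , pairs) y∉N =
    All.zipWith (λ (y≢ , h) → ∖-edge⁺ {H} y≢ h) (∉-map⇒All≢ proj₂ y∉N , edges) , pairs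

  IsMatching-∖⁻ : ∀ {H : Bip c p} {N y} → IsMatching (H ∖ y) N → IsMatching H N × y ∉ endsP N
  IsMatching-∖⁻ {H} (edges , pairs) =
    (All.map (proj₁ ∘ ∖-edge⁻ {H}) edges , pairs) ,
    All≢⇒∉-map proj₂ (All.map (proj₂ ∘ ∖-edge⁻ {H}) edges)

  IsMatching-↭-∷ : ∀ {H : Bip c p} {N N₁ x y} → IsMatching H N → N ↭ (x , y) ∷ N₁ →
    T (H x y) × x ∉ endsC N₁ × IsMatching (H ∖ y) N₁
  IsMatching-↭-∷ mN N↭ with hxy ∷ edges , disjoint ∷ pairs ← IsMatching-resp-↭ N↭ mN =
    hxy , All≢⇒∉-map proj₁ (All.map proj₁ disjoint) ,
    IsMatching-∖⁺ (edges , pairs) (All≢⇒∉-map proj₂ (All.map proj₂ disjoint))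

  uncovered-edge : ∀ {N M : List (Edge c p)} → AllPairs Disjoint M → length N < length M →
    ∃₂ λ e M₁ → M ↭ e ∷ M₁ × proj₁ e ∉ endsC N
  uncovered-edge {N} {M} pairs N<M
    with x , x∈M , x∉N ← ∃∉-longer _≟_ (Unique-endsC pairs)
                           (subst₂ _<_ (sym (length-map proj₁ N)) (sym (length-map proj₁ M)) N<M)
    with e , M₁ , M↭ , refl ← ∈-map⇒↭ proj₁ x∈M
    = e , M₁ , M↭ , x∉N

  record Augmentation (H : Bip c p) (N : List (Edge c p)) : Set where
    constructor augmentation
    field
      matching : List (Edge c p)
      newEnd : Fin c
      isMatching : IsMatching H matching
      endsC-↭ : endsC matching ↭ newEnd ∷ endsC N

  reroute : ∀ {H : Bip c p} {N N₁ x x′ y} → IsMatching H N → N ↭ (x′ , y) ∷ N₁ →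
    T (H x y) → x ∉ endsC N → Augmentation (H ∖ y) N₁ → Augmentation H N
  reroute {N = N} {N₁} {x} {x′} {y} mN N↭ hxy x∉N (augmentation N₁′ z mN₁′ N₁′↭)
    with hx′y , x′∉N₁ , _ ← IsMatching-↭-∷ mN N↭
    with mN₁′ᴴ , y∉N₁′ ← IsMatching-∖⁻ mN₁′
    with z ≟ x′
  ... | yes refl =
    augmentation ((x , y) ∷ N₁′) x (IsMatching-∷ mN₁′ᴴ hxy x∉N₁′ y∉N₁′) (prep x N₁′↭N)
    where
    N₁′↭N : endsC N₁′ ↭ endsC N
    N₁′↭N = ↭-trans N₁′↭ (↭-sym (↭-map⁺ proj₁ N↭))
    x∉N₁′ : x ∉ endsC N₁′
    x∉N₁′ = ∉-resp-↭ (↭-sym N₁′↭N) x∉N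
  ... | no z≢x′ =
    augmentation ((x′ , y) ∷ N₁′) z (IsMatching-∷ mN₁′ᴴ hx′y x′∉N₁′ y∉N₁′) x′∷N₁′↭z∷N
    where
    x′∉N₁′ : x′ ∉ endsC N₁′
    x′∉N₁′ x′∈N₁′ with ∈-resp-↭ N₁′↭ x′∈N₁′
    ... | here x′≡z = z≢x′ (sym x′≡z)
    ... | there x′∈N₁ = x′∉N₁ x′∈N₁
    x′∷N₁′↭z∷N : x′ ∷ endsC N₁′ ↭ z ∷ endsC N
    x′∷N₁′↭z∷N = begin
      x′ ∷ endsC N₁′     <⟨ N₁′↭ ⟩
      x′ ∷ z ∷ endsC N₁  <<⟨ ↭-refl ⟩
      z ∷ x′ ∷ endsC N₁  ↭⟨ prep z (↭-sym (↭-map⁺ proj₁ N↭)) ⟩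
      z ∷ endsC N        ∎
      where open PermutationReasoning

  augment : ∀ {H : Bip c p} {N M} → Acc _<_ (length N) → IsMatching H N → IsMatching H M →
    length N < length M → Augmentation H N
  augment {N = N} (acc smaller) mN mM N<M
    with (x , y) , M₁ , M↭ , x∉N ← uncovered-edge (proj₂ mM) N<M
    with hxy , _ , mM₁ ← IsMatching-↭-∷ mM M↭
    with y ∈? endsP N
  ... | no y∉N = augmentation ((x , y) ∷ N) x (IsMatching-∷ mN hxy x∉N y∉N) ↭-refl
  ... | yes y∈N with (x′ , _) , N₁ , N↭ , refl ← ∈-map⇒↭ proj₂ y∈N
    with _ , _ , mN₁ ← IsMatching-↭-∷ mN N↭
    = reroute mN N↭ hxy x∉N (augment (smaller N₁<N) mN₁ mM₁ N₁<M₁)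
    where
    N₁<N : length N₁ < length N
    N₁<N = ≤-reflexive (sym (↭-length N↭))
    N₁<M₁ : length N₁ < length M₁
    N₁<M₁ = s<s⁻¹ (subst₂ _<_ (↭-length N↭) (↭-length M↭) N<M)

  module _ {ℓ} {P : Pred (Fin c) ℓ} (P? : Decidable P) where

    countC : List (Edge c p) → ℕ
    countC N = length (filter (P? ∘ proj₁) N)

    countC-↭-∷ : ∀ {N N′ z} → endsC N′ ↭ z ∷ endsC N →
      countC N′ ≡ length (filter P? (z ∷ endsC N))
    countC-↭-∷ {N′ = N′} N′↭ =
      trans (sym (length-filter-map proj₁ P? N′)) (↭-length (filter-↭ P? N′↭))

    countC-↭-∷-≤ : ∀ {N N′ z} → endsC N′ ↭ z ∷ endsC N → countC N ≤ countC N′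
    countC-↭-∷-≤ {N} {z = z} N′↭ =
      subst₂ _≤_ (length-filter-map proj₁ P? N) (sym (countC-↭-∷ N′↭))
        (length-filter-≤-∷ P? z (endsC N))

    countC-↭-∷-< : ∀ {N N′ z} → endsC N′ ↭ z ∷ endsC N → P z → countC N < countC N′
    countC-↭-∷-< {N} N′↭ pz =
      subst₂ _<_ (length-filter-map proj₁ P? N) (sym (countC-↭-∷ N′↭))
        (length-filter-<-∷ P? (endsC N) pz)

fact1 : (c p k : ℕ) (H : Bip c p) (cls : Fin c → Fin k) (N : List (Edge c p)) →
        IsRankMaximal H cls N → IsMaximum H N
fact1 c p k H cls N (mN , rankMaximal) = mN , λ M mM → ≮⇒≥ (not-smaller mM)
  where
  rankCount : List (Edge c p) → Fin k → ℕ
  rankCount L i = countC (λ x → cls x ≟ i) L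

  not-smaller : ∀ {M} → IsMatching H M → ¬ length N < length M
  not-smaller mM N<M with augmentation N′ z mN′ N′↭ ← augment (<-wellFounded _) mN mM N<M =
    tabulate-≰lex (rankCount N) (rankCount N′)
      (λ i → countC-↭-∷-≤ (λ x → cls x ≟ i) N′↭)
      (countC-↭-∷-< (λ x → cls x ≟ cls z) N′↭ refl)
      (rankMaximal N′ mN′)
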